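{- Let $I=(S,\mathcal{F},k,c,p,B)$ be a BLM instance and let $X\in\mathcal{F}\setminus\{S\}$ be a maximal set. Then: (1) for any $Q_1\in\mathcal{I}(I\cap X)$ and $Q_2\in\mathcal{I}(I\setminus X)$ such that $|Q_1\uplus Q_2|\leq k(S)$, we have $Q_1\uplus Q_2\in\mathcal{I}(I)$; (2) for any $Q\in\mathcal{I}(I)$, we have $Q\cap X\in\mathcal{I}(I\cap X)$ and $Q\setminus X\in\mathcal{I}(I\setminus X)$.
   Context: A family $\mathcal{F}\subseteq 2^S\setminus\{\emptyset\}$ on a finite set $S$ is laminar if for all $X,Y\in\mathcal{F}$ either $X\cap Y=\emptyset$, $X\subseteq Y$, or $Y\subseteq X$. For a laminar family $\mathcal{F}$ on $S$ and $k:\mathcal{F}\to\mathbb{N}_{>0}$, let $\mathcal{I}_{\mathcal{F},k}=\{A\subseteq S : |A\cap X|\leq k(X)\ \forall X\in\mathcal{F}\}$. A BLM instance is a tuple $I=(S,\mathcal{F},k,c,p,B)$ with $S$ finite, $\mathcal{F}$ a laminar family on $S$ with $S\in\mathcal{F}$, $k:\mathcal{F}\to\mathbb{N}_{>0}$, $c,p:S\to\mathbb{N}$, $B\in\mathbb{N}$; write $\mathcal{I}(I)=\mathcal{I}_{\mathcal{F},k}$. A set $X\in\mathcal{F}\setminus\{S\}$ is maximal if it is not contained in any other set of $\mathcal{F}\setminus\{S\}$. For $G\subseteq S$ let $\mathcal{F}_{\subseteq G}=\{Y\in\mathcal{F}: Y\subseteq G\}$. For a maximal $X$, define $I\cap X=(X,\mathcal{F}_{\subseteq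 X},k,c,p,B)$ (with $k,c,p$ restricted) and $I\setminus X=(S\setminus X,\ \mathcal{F}_{\subseteq(S\setminus X)}\cup\{S\setminus X\},\ \bar{k},c,p,B)$, where $\bar{k}(Y)=k(Y)$ if $Y\in\mathcal{F}$ and $\bar{k}(Y)=k(S)$ otherwise (i.e. for $Y=S\setminus X\notin\mathcal{F}$). $\uplus$ denotes disjoint union. -}

module Defs where

open import Data.Nat using (ℕ; _≤_; _<_)
open import Data.Bool using (Bool)
open import Data.Bool.Properties using () renaming (_≟_ to _≟ᵇ_)
open import Data.Fin using (Fin)
open import Data.Fin.Subset using (Subset; _⊆_; _∩_; _∪_; _─_; ∣_∣; ⊥)
open import Data.Fin.Subset.Properties using (_⊆?_)
open import Data.Vec.Properties using (≡-dec)
open import Data.List using (List; filter; _++_; [_])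
open import Data.Sum using (_⊎_)
open import Data.Product using (_×_)
open import Relation.Binary.PropositionalEquality using (_≡_; _≢_)
open import Relation.Binary.Definitions using (DecidableEquality)
open import Relation.Nullary using (yes; no)

_≟ₛ_ : ∀ {n} → DecidableEquality (Subset n)
_≟ₛ_ = ≡-dec _≟ᵇ_

open import Data.List.Membership.Propositional using (_∈_) public
import Data.List.Membership.DecPropositional

_∈F?_ : ∀ {n} (Y : Subset n) (F : List (Subset n)) → Relation.Nullary.Dec (Y ∈ F)
_∈F?_ {n} Y F = DP._∈?_ Y F
  where module DP = Data.List.Membership.DecPropositional (_≟ₛ_ {n})

Laminar : ∀ {n} → Subset n → List (Subset n) → Set
Laminar {n} G F =
  (∀ {X} → X ∈ F → (X ≢ ⊥) × (X ⊆ G)) ×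
  (∀ {X Y} → X ∈ F → Y ∈ F → ((X ∩ Y) ≡ ⊥) ⊎ (X ⊆ Y) ⊎ (Y ⊆ X))

Indep : ∀ {n} → Subset n → List (Subset n) → (Subset n → ℕ) → Subset n → Set
Indep G F k A = (A ⊆ G) × (∀ {X} → X ∈ F → ∣ A ∩ X ∣ ≤ k X)

-- A BLM instance over the universe Fin n; the ground set S is a subset of Fin n.
-- k is given as a total function on subsets; only its values on F matter.
record BLM (n : ℕ) : Set where
  field
    S : Subset n
    F : List (Subset n)
    k : Subset n → ℕ
    c : Fin n → ℕ
    p : Fin n → ℕ
    B : ℕ
    laminar : Laminar S F
    S∈F : S ∈ F
    k-pos : ∀ {X} → X ∈ F → 0 < k X

IndepI : ∀ {n} → BLM n → Subset n → Set
IndepI I A = Indep (BLM.S I) (BLM.F I) (BLM.k I) A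

Maximal : ∀ {n} → BLM n → Subset n → Set
Maximal I X = (X ∈ BLM.F I) × (X ≢ BLM.S I) ×
  (∀ {Y} → Y ∈ BLM.F I → Y ≢ BLM.S I → X ⊆ Y → Y ≡ X)

F⊆ : ∀ {n} → List (Subset n) → Subset n → List (Subset n)
F⊆ F G = filter (λ Y → Y ⊆? G) F


kbar : ∀ {n} → BLM n → Subset n → ℕ
kbar I Y with Y ∈F? BLM.F I
... | yes _ = BLM.k I Y
... | no _ = BLM.k I (BLM.S I)

IndepCap : ∀ {n} → BLM n → Subset n → Subset n → Set
IndepCap I X A = Indep X (F⊆ (BLM.F I) X) (BLM.k I) A

IndepMinus : ∀ {n} → BLM n → Subset n → Subset n → Set
IndepMinus I X A =
  Indep (BLM.S I ─ X) (F⊆ (BLM.F I) (BLM.S I ─ X) ++ [ BLM.S I ─ X ]) (kbar I) A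

{-# OPTIONS --safe #-}
-- Because X is maximal, every member of F other than S is either disjoint from X or
-- contained in X.  A member inside X meets Q₁ ∪ Q₂ only in Q₁, a member disjoint from
-- X only in Q₂ (where k̄ agrees with k), and S is handled by the cardinality bound.
-- Conversely, independence is closed under shrinking the set and the family, and the
-- one new constraint of I ∖ X, on S ∖ X, has capacity k(S) and so follows from the
-- constraint on S.
module Submission where

open import Defs
open import Data.Nat using (ℕ; _≤_)
open import Data.Nat.Properties using (≤-trans)
open import Data.Fin using (Fin)
open import Data.Fin.Subset using (Subset; _∩_; _∪_; _─_; ∣_∣; _⊆_; ⊥; inside; outside)
  renaming (_∈_ to _∈ₛ_; _∉_ to _∉ₛ_)
open import Data.Fin.Subset.Properties
  using (_⊆?_; ⊆-trans; ⊆-reflexive; p⊆q⇒∣p∣≤∣q∣; ∉⊥; x∈p∩q⁺; x∈p∩q⁻; p∩q⊆p; p∩q⊆q;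
         x∈p∪q⁻; x∈p∧x∉q⇒x∈p─q; p─q⊆p)
open import Data.Vec using (_∷_)
open import Data.Vec.Base using (here; there)
open import Data.List using (List)
open import Data.List.Membership.Propositional.Properties using (∈-filter⁺; ∈-filter⁻; ∈-++⁺ˡ)
open import Data.Product using (_×_; _,_; proj₁; proj₂)
open import Data.Sum using (_⊎_; inj₁; inj₂; [_,_])
open import Relation.Binary.PropositionalEquality using (_≡_; refl; subst)
open import Relation.Nullary using (yes; no)
open import Data.Empty using (⊥-elim)

private variable
  n m : ℕ
  x : Fin n
  p q r G G′ : Subset n
  ℱ ℱ′ : List (Subset n)
  κ : Subset n → ℕ

x∈p─q⇒x∉q : ∀ (p q : Subset n) → x ∈ₛ p ─ q → x ∉ₛ q
x∈p─q⇒x∉q (inside ∷ p) (outside ∷ q) here ()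
x∈p─q⇒x∉q (_ ∷ p) (_ ∷ q) (there x∈p─q) (there x∈q) = x∈p─q⇒x∉q p q x∈p─q x∈q

p∩q≡⊥⇒x∈p⇒x∉q : p ∩ q ≡ ⊥ → x ∈ₛ p → x ∉ₛ q
p∩q≡⊥⇒x∈p⇒x∉q {x = x} p∩q≡⊥ x∈p x∈q = ∉⊥ (subst (x ∈ₛ_) p∩q≡⊥ (x∈p∩q⁺ (x∈p , x∈q)))

∪-least : p ⊆ r → q ⊆ r → p ∪ q ⊆ r
∪-least {p = p} {q = q} p⊆r q⊆r x∈p∪q = [ p⊆r , q⊆r ] (x∈p∪q⁻ p q x∈p∪q)

∩-monoˡ-⊆ : p ⊆ q → p ∩ r ⊆ q ∩ r
∩-monoˡ-⊆ {p = p} {r = r} p⊆q x∈p∩r =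
  let x∈p , x∈r = x∈p∩q⁻ p r x∈p∩r in x∈p∩q⁺ (p⊆q x∈p , x∈r)

─-monoˡ-⊆ : p ⊆ q → p ─ r ⊆ q ─ r
─-monoˡ-⊆ {p = p} {r = r} p⊆q x∈p─r =
  x∈p∧x∉q⇒x∈p─q (p⊆q (p─q⊆p p r x∈p─r)) (x∈p─q⇒x∉q p r x∈p─r)

p⊆q⇒p⊆p∩q : p ⊆ q → p ⊆ p ∩ q
p⊆q⇒p⊆p∩q p⊆q x∈p = x∈p∩q⁺ (x∈p , p⊆q x∈p)

p⊆q∧r∩p≡⊥⇒p⊆q─r : p ⊆ q → r ∩ p ≡ ⊥ → p ⊆ q ─ r
p⊆q∧r∩p≡⊥⇒p⊆q─r p⊆q r∩p≡⊥ x∈p =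
  x∈p∧x∉q⇒x∈p─q (p⊆q x∈p) (λ x∈r → p∩q≡⊥⇒x∈p⇒x∉q r∩p≡⊥ x∈r x∈p)

[p∪q]∩r⊆q∩r : (∀ {x} → x ∈ₛ p → x ∉ₛ r) → (p ∪ q) ∩ r ⊆ q ∩ r
[p∪q]∩r⊆q∩r {p = p} {r = r} {q = q} p∩r-empty x∈[p∪q]∩r
  with x∈p∪q , x∈r ← x∈p∩q⁻ (p ∪ q) r x∈[p∪q]∩r
  with x∈p∪q⁻ p q x∈p∪q
... | inj₁ x∈p = ⊥-elim (p∩r-empty x∈p x∈r)
... | inj₂ x∈q = x∈p∩q⁺ (x∈q , x∈r)

[p∪q]∩r⊆p∩r : (∀ {x} → x ∈ₛ q → x ∉ₛ r) → (p ∪ q) ∩ r ⊆ p ∩ r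
[p∪q]∩r⊆p∩r {q = q} {r = r} {p = p} q∩r-empty x∈[p∪q]∩r
  with x∈p∪q , x∈r ← x∈p∩q⁻ (p ∪ q) r x∈[p∪q]∩r
  with x∈p∪q⁻ p q x∈p∪q
... | inj₁ x∈p = x∈p∩q⁺ (x∈p , x∈r)
... | inj₂ x∈q = ⊥-elim (q∩r-empty x∈q x∈r)

p⊆q∧∣q∣≤m⇒∣p∣≤m : p ⊆ q → ∣ q ∣ ≤ m → ∣ p ∣ ≤ m
p⊆q∧∣q∣≤m⇒∣p∣≤m p⊆q = ≤-trans (p⊆q⇒∣p∣≤∣q∣ p⊆q)

∈-F⊆⁺ : q ∈ ℱ → q ⊆ G → q ∈ F⊆ ℱ G
∈-F⊆⁺ {G = G} = ∈-filter⁺ (_⊆? G)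

∈-F⊆⁻ : q ∈ F⊆ ℱ G → q ∈ ℱ
∈-F⊆⁻ {ℱ = ℱ} {G = G} q∈F⊆ = proj₁ (∈-filter⁻ (_⊆? G) {xs = ℱ} q∈F⊆)

Indep-⊆ : p ⊆ q → Indep G ℱ κ q → Indep G ℱ κ p
Indep-⊆ p⊆q (q⊆G , bounded) =
  ⊆-trans p⊆q q⊆G , λ Y∈ℱ → p⊆q∧∣q∣≤m⇒∣p∣≤m (∩-monoˡ-⊆ p⊆q) (bounded Y∈ℱ)

Indep-restrict : p ⊆ G → (∀ {Y} → Y ∈ ℱ′ → Y ∈ ℱ) → Indep G′ ℱ κ p → Indep G ℱ′ κ p
Indep-restrict p⊆G ℱ′⊆ℱ (_ , bounded) = p⊆G , λ Y∈ℱ′ → bounded (ℱ′⊆ℱ Y∈ℱ′)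

module _ (I : BLM n) where
  open BLM I

  kbar-∈ : ∀ {Y} → Y ∈ F → kbar I Y ≡ k Y
  kbar-∈ {Y} Y∈F with Y ∈F? F
  ... | yes _ = refl
  ... | no Y∉F = ⊥-elim (Y∉F Y∈F)

  IndepI⇒∣∩∣≤kbar : ∀ {A} → IndepI I A → ∀ Y → ∣ A ∩ Y ∣ ≤ kbar I Y
  IndepI⇒∣∩∣≤kbar {A} (A⊆S , bounded) Y with Y ∈F? F
  ... | yes Y∈F = bounded Y∈F
  ... | no _ = p⊆q∧∣q∣≤m⇒∣p∣≤m (⊆-trans (p∩q⊆p A Y) (p⊆q⇒p⊆p∩q A⊆S)) (bounded S∈F)

  Maximal⇒disjoint⊎⊆⊎≡S : ∀ {X Y} → Maximal I X → Y ∈ F → X ∩ Y ≡ ⊥ ⊎ Y ⊆ X ⊎ Y ≡ S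
  Maximal⇒disjoint⊎⊆⊎≡S {X} {Y} (X∈F , _ , maximal) Y∈F with proj₂ laminar X∈F Y∈F
  ... | inj₁ X∩Y≡⊥ = inj₁ X∩Y≡⊥
  ... | inj₂ (inj₂ Y⊆X) = inj₂ (inj₁ Y⊆X)
  ... | inj₂ (inj₁ X⊆Y) with Y ≟ₛ S
  ...   | yes Y≡S = inj₂ (inj₂ Y≡S)
  ...   | no Y≢S = inj₂ (inj₁ (⊆-reflexive (maximal Y∈F Y≢S X⊆Y)))

  IndepCap∧IndepMinus⇒IndepI-∪ : ∀ {X Q₁ Q₂} → Maximal I X →
    IndepCap I X Q₁ → IndepMinus I X Q₂ → ∣ Q₁ ∪ Q₂ ∣ ≤ k S → IndepI I (Q₁ ∪ Q₂)
  IndepCap∧IndepMinus⇒IndepI-∪ {X} {Q₁} {Q₂} max@(X∈F , _)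
    (Q₁⊆X , bounded₁) (Q₂⊆S─X , bounded₂) ∣Q∣≤kS =
    ∪-least (⊆-trans Q₁⊆X (∈F⇒⊆S X∈F)) (⊆-trans Q₂⊆S─X (p─q⊆p S X)) , bounded
    where
    ∈F⇒⊆S : ∀ {Y} → Y ∈ F → Y ⊆ S
    ∈F⇒⊆S Y∈F = proj₂ (proj₁ laminar Y∈F)

    Q₂∩X-empty : ∀ {x} → x ∈ₛ Q₂ → x ∉ₛ X
    Q₂∩X-empty x∈Q₂ = x∈p─q⇒x∉q S X (Q₂⊆S─X x∈Q₂)

    bounded : ∀ {Y} → Y ∈ F → ∣ (Q₁ ∪ Q₂) ∩ Y ∣ ≤ k Y
    bounded {Y} Y∈F with Maximal⇒disjoint⊎⊆⊎≡S max Y∈F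
    ... | inj₁ X∩Y≡⊥ =
      p⊆q∧∣q∣≤m⇒∣p∣≤m ([p∪q]∩r⊆q∩r (λ x∈Q₁ → p∩q≡⊥⇒x∈p⇒x∉q X∩Y≡⊥ (Q₁⊆X x∈Q₁)))
        (subst (_ ≤_) (kbar-∈ Y∈F)
          (bounded₂ (∈-++⁺ˡ (∈-F⊆⁺ Y∈F (p⊆q∧r∩p≡⊥⇒p⊆q─r (∈F⇒⊆S Y∈F) X∩Y≡⊥)))))
    ... | inj₂ (inj₁ Y⊆X) =
      p⊆q∧∣q∣≤m⇒∣p∣≤m ([p∪q]∩r⊆p∩r {p = Q₁} (λ x∈Q₂ x∈Y → Q₂∩X-empty x∈Q₂ (Y⊆X x∈Y)))
        (bounded₁ (∈-F⊆⁺ Y∈F Y⊆X))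
    ... | inj₂ (inj₂ refl) = p⊆q∧∣q∣≤m⇒∣p∣≤m (p∩q⊆p (Q₁ ∪ Q₂) S) ∣Q∣≤kS

  IndepI⇒IndepCap-∩ : ∀ {X Q} → IndepI I Q → IndepCap I X (Q ∩ X)
  IndepI⇒IndepCap-∩ {X} {Q} Q-indep =
    Indep-restrict (p∩q⊆q Q X) ∈-F⊆⁻ (Indep-⊆ (p∩q⊆p Q X) Q-indep)

  IndepI⇒IndepMinus-─ : ∀ {X Q} → IndepI I Q → IndepMinus I X (Q ─ X)
  IndepI⇒IndepMinus-─ {X} {Q} Q-indep@(Q⊆S , _) =
    ─-monoˡ-⊆ Q⊆S , λ {Y} _ → IndepI⇒∣∩∣≤kbar (Indep-⊆ (p─q⊆p Q X) Q-indep) Y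

mainTheorem2 : ∀ {n} (I : BLM n) (X : Subset n) → Maximal I X →
    (∀ Q₁ Q₂ → IndepCap I X Q₁ → IndepMinus I X Q₂ →
      ∣ Q₁ ∪ Q₂ ∣ ≤ BLM.k I (BLM.S I) → IndepI I (Q₁ ∪ Q₂)) ×
    (∀ Q → IndepI I Q → IndepCap I X (Q ∩ X) × IndepMinus I X (Q ─ X))
mainTheorem2 I X max =
  (λ _ _ → IndepCap∧IndepMinus⇒IndepI-∪ I max) ,
  (λ _ Q-indep → IndepI⇒IndepCap-∩ I Q-indep , IndepI⇒IndepMinus-─ I Q-indep)
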